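{- $\mathsf{TC}^{(n)}_{A,(s,r)}$ is a $n$-truncated MDS tree code with distance $r/(r+s)$.
   Context: Let $\mathbb{F}$ be a finite field and $r,s\geq 1$ integers. A lower-triangular matrix $A \in \mathbb{F}^{N \times N}$ is totally-non-singular if for every $1\le t\le N$ and all $I=\{i_1<\dots<i_t\}$, $J=\{j_1<\dots<j_t\}\subseteq[N]$ with $i_q\ge j_q$ for all $q\in[t]$, the submatrix $A[I|J]$ (rows $I$, columns $J$) is non-singular. Let $A\in \mathbb{F}^{(r+s)n\times (r+s)n}$ be a totally-non-singular lower-triangular matrix, and for $m\le (r+s)n$ let $A^{(m)}$ be its top-left $m\times m$ submatrix. For $v\in \mathbb{F}^s$ let $v'\in \mathbb{F}^{r+s}$ be obtained by appending $r$ zeros to $v$, and for $x\in (\mathbb{F}^s)^k$ let $x'=(x_1',\ldots,x_k')\in \mathbb{F}^{(r+s)k}$. For $k\le n$, define $\mathsf{TC}^{(n)}_{A,(s,r)}\colon(\mathbb{F}^s)^{(\leq n)}\to (\mathbb{F}^{r+s})^{(\leq n)}$ by $x \in (\mathbb{F}^s)^k \mapsto A^{((r+s)k)}x' \in (\mathbb{F}^{r+s})^k$. An $n$-truncated tree code $\mathsf{TC}^{(n)}\colon\Sigma^{(\le n)}\to\Gamma^{(\le n)}$ (online encoding: the $i$-th output symbol depends only on the first $i$ input symbols) has distance $\delta_{\mathsf{TC}^{(n)}}=\inf_{i\le n,\,x\ne x'\in\Sigma^i}\Delta(\mathsf{TC}(x),\mathsf{TC}(x'))/(i-\operatorname{split}(x,x'))$,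 where $\Delta$ is Hamming distance over $\Gamma$ and $\operatorname{split}(x,x')$ is the length of the longest common prefix of $x,x'$. It is maximum-distance separable (MDS) if $\delta_{\mathsf{TC}^{(n)}} > 1- \log |\Sigma|/\log |\Gamma|$ (here $\Sigma=\mathbb{F}^s$, $\Gamma=\mathbb{F}^{r+s}$, so this threshold is $r/(r+s)$). -}

module Defs where

open import Level using (_⊔_)
import Level
open import Algebra.Bundles using (CommutativeRing)
import Data.Nat as ℕ
open ℕ using (ℕ; zero; suc; _≤_; _<_)
open import Data.Nat.Properties using (m≤n+m; *-monoˡ-≤)
open import Data.Fin as Fin using (Fin; toℕ; inject≤; combine; remQuot; punchIn)
open import Data.Fin.Properties using (all?)
open import Data.Product using (Σ; ∃; _×_; _,_; uncurry)
open import Data.List using (List)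
open import Data.List.Relation.Unary.Any using (Any)
open import Relation.Nullary using (¬_; Dec; yes; no)
open import Relation.Binary using (Decidable)

record FiniteField c ℓ : Set (Level.suc (c ⊔ ℓ)) where
  field
    commutativeRing : CommutativeRing c ℓ
  open CommutativeRing commutativeRing public
  field
    _≟_      : Decidable _≈_
    0≉1      : ¬ (0# ≈ 1#)
    inverse  : ∀ x → ¬ (x ≈ 0#) → ∃ λ y → x * y ≈ 1#
    elements : List Carrier
    complete : ∀ x → Any (x ≈_) elements

module _ {c ℓ} (F : FiniteField c ℓ) where
  open FiniteField F

  Matrix : ℕ → Set c
  Matrix m = Fin m → Fin m → Carrier

  ∑ : ∀ {m} → (Fin m → Carrier) → Carrier
  ∑ {zero}  f = 0#
  ∑ {suc m} f = f Fin.zero + ∑ (λ i → f (Fin.suc i))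

  negPow : ℕ → Carrier → Carrier
  negPow zero    x = x
  negPow (suc k) x = - negPow k x

  det : ∀ {t} → Matrix t → Carrier
  det {zero}  M = 1#
  det {suc t} M = ∑ λ j → negPow (toℕ j) (M Fin.zero j * det (λ a b → M (Fin.suc a) (punchIn j b)))

  NonSingular : ∀ {t} → Matrix t → Set ℓ
  NonSingular M = ¬ (det M ≈ 0#)

  LowerTriangular : ∀ {N} → Matrix N → Set ℓ
  LowerTriangular {N} A = ∀ (i j : Fin N) → toℕ i < toℕ j → A i j ≈ 0#

  StrictlyIncreasing : ∀ {t N} → (Fin t → Fin N) → Set
  StrictlyIncreasing I = ∀ a b → toℕ a < toℕ b → toℕ (I a) < toℕ (I b)

  TotallyNonSingular : ∀ {N} → Matrix N → Set ℓ
  TotallyNonSingular {N} A =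
    LowerTriangular A ×
    (∀ (t : ℕ) → 1 ≤ t → t ≤ N → (I J : Fin t → Fin N) →
       StrictlyIncreasing I → StrictlyIncreasing J →
       (∀ q → toℕ (J q) ≤ toℕ (I q)) →
       NonSingular (λ a b → A (I a) (J b)))

  topLeft : ∀ {N m} → Matrix N → m ≤ N → Matrix m
  topLeft A m≤N i j = A (inject≤ i m≤N) (inject≤ j m≤N)

  mulV : ∀ {m} → Matrix m → (Fin m → Carrier) → Fin m → Carrier
  mulV M v i = ∑ λ j → M i j * v j

  Word : ℕ → ℕ → Set c
  Word d k = Fin k → Fin d → Carrier

  flatten : ∀ {d k} → Word d k → Fin (k ℕ.* d) → Carrier
  flatten {d} x j = uncurry x (remQuot d j)

  unflatten : ∀ {d k} → (Fin (k ℕ.* d) → Carrier) → Word d k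
  unflatten y b p = y (combine b p)

  pad : ∀ (r s : ℕ) → (Fin s → Carrier) → Fin (r ℕ.+ s) → Carrier
  pad r s v q with toℕ q ℕ.<? s
  ... | yes q<s = v (Fin.fromℕ< q<s)
  ... | no  _   = 0#

  -- the tree code TC^{(n)}_{A,(s,r)} : (F^s)^k ↦ A^{((r+s)k)} x' ∈ (F^{r+s})^k, for k ≤ n
  TC : ∀ (n r s : ℕ) → Matrix (n ℕ.* (r ℕ.+ s)) →
       ∀ (k : ℕ) → k ≤ n → Word s k → Word (r ℕ.+ s) k
  TC n r s A k k≤n x =
    unflatten (mulV (topLeft A (*-monoˡ-≤ (r ℕ.+ s) k≤n)) (flatten (λ b → pad r s (x b))))

  SymEq : ∀ {d} → (Fin d → Carrier) → (Fin d → Carrier) → Set ℓ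
  SymEq u v = ∀ p → u p ≈ v p

  symEq? : ∀ {d} (u v : Fin d → Carrier) → Dec (SymEq u v)
  symEq? u v = all? (λ p → u p ≟ v p)

  WordEq : ∀ {d k} → Word d k → Word d k → Set ℓ
  WordEq x y = ∀ b → SymEq (x b) (y b)

  Δ : ∀ {d k} → Word d k → Word d k → ℕ
  Δ {k = zero}  x y = 0
  Δ {k = suc k} x y with symEq? (x Fin.zero) (y Fin.zero)
  ... | yes _ = Δ (λ b → x (Fin.suc b)) (λ b → y (Fin.suc b))
  ... | no  _ = suc (Δ (λ b → x (Fin.suc b)) (λ b → y (Fin.suc b)))

  split : ∀ {d k} → Word d k → Word d k → ℕ
  split {k = zero}  x y = 0
  split {k = suc k} x y with symEq? (x Fin.zero) (y Fin.zero)
  ... | yes _ = suc (split (λ b → x (Fin.suc b)) (λ b → y (Fin.suc b)))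
  ... | no  _ = 0

  -- Since the set of pairs is finite,
  -- inf_{i,x≠x'} Δ/(i − split) > r/(r+s) iff every ratio exceeds r/(r+s);
  -- cross-multiplied: (r+s)·Δ > r·(i − split).
  IsMDS-TC : ∀ (n r s : ℕ) → Matrix (n ℕ.* (r ℕ.+ s)) → Set (c ⊔ ℓ)
  IsMDS-TC n r s A =
    ∀ (i : ℕ) (i≤n : i ≤ n) (x y : Word s i) → ¬ WordEq x y →
      r ℕ.* (i ℕ.∸ split x y) < (r ℕ.+ s) ℕ.* Δ (TC n r s A i i≤n x) (TC n r s A i i≤n y)

-- Let x ≠ y first differ in block L and put z = x′ − y′ (padded inputs), so that
-- A z is the difference of the two encodings. Scan the blocks from L on, keeping
-- the number of input columns of z not yet matched: every block brings its s
-- input columns, and every block on which the encodings agree offers its r + s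
-- rows, on which A z vanishes, to match pending columns in order. If the matching
-- never completes, counting columns against rows gives r (i − L) < (r + s) Δ.
-- If it completes, the chosen rows R and columns C are equinumerous and
-- interlaced (the q-th column never lies right of the q-th row), so A[R|C] is
-- non-singular by total non-singularity. Cut off after the last block used, z is
-- supported in C and, A being lower triangular, still annihilated on R; hence it
-- vanishes, contradicting x_L ≠ y_L.
module Submission where

open import Defs
open import Data.Nat using (ℕ; zero; suc; z≤n; s≤s)
import Data.Nat as ℕ
import Data.Nat.Properties as ℕ
open import Data.Fin using (Fin; zero; suc; toℕ; combine; remQuot; punchIn; inject≤)
import Data.Fin as Fin
import Data.Fin.Properties as Fin
open import Data.Fin.Subset using (Subset; inside; outside; _∈_; _∉_; ∣_∣)
open import Data.Fin.Subset.Properties using (∣p∣≤n; drop-there)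
open import Function using (_∘_; id)
open import Data.Bool using (Bool; true; false; if_then_else_; T)
open import Data.Vec using ([]; _∷_; lookup; _++_; concat; tabulate; here; there)
open import Data.Vec.Properties using (lookup-concat; lookup∘tabulate; []=⇒lookup; lookup⇒[]=)
open import Data.Product using (Σ; ∃; _×_; _,_; proj₁; proj₂)
import Data.Product as Product
open import Data.Sum using (_⊎_; inj₁; inj₂)
import Data.Sum as Sum
open import Relation.Nullary using (yes; no; ¬_; contradiction)
open import Relation.Binary.Definitions using (tri<; tri≈; tri>)
open import Relation.Binary.PropositionalEquality using (_≡_; _≢_; refl; sym; trans; cong; cong₂; subst; subst₂)

module Ballots where
  open import Data.Nat using (_+_; _≤_; _<_)

  variable
    n m e e₁ e₂ : ℕ

  enumerate : (p : Subset n) → Fin ∣ p ∣ → Fin n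
  enumerate (inside ∷ p) zero = zero
  enumerate (inside ∷ p) (suc a) = suc (enumerate p a)
  enumerate (outside ∷ p) a = suc (enumerate p a)

  enumerate-∈ : (p : Subset n) (a : Fin ∣ p ∣) → enumerate p a ∈ p
  enumerate-∈ (inside ∷ p) zero = here
  enumerate-∈ (inside ∷ p) (suc a) = there (enumerate-∈ p a)
  enumerate-∈ (outside ∷ p) a = there (enumerate-∈ p a)

  enumerate-surjective : (p : Subset n) {k : Fin n} → k ∈ p → ∃ λ a → enumerate p a ≡ k
  enumerate-surjective (inside ∷ p) here = zero , refl
  enumerate-surjective (inside ∷ p) (there k∈p) with a , refl ← enumerate-surjective p k∈p = suc a , refl
  enumerate-surjective (outside ∷ p) (there k∈p) with a , refl ← enumerate-surjective p k∈p = a , refl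

  enumerate-mono-< : (p : Subset n) {a b : Fin ∣ p ∣} → a Fin.< b → enumerate p a Fin.< enumerate p b
  enumerate-mono-< (inside ∷ p) {zero} {suc b} _ = s≤s z≤n
  enumerate-mono-< (inside ∷ p) {suc a} {suc b} (s≤s a<b) = s≤s (enumerate-mono-< p a<b)
  enumerate-mono-< (outside ∷ p) a<b = s≤s (enumerate-mono-< p a<b)

  -- Ballot e₁ e₂ R C: scanning both subsets from the left with a counter that
  -- starts at e₁, an element of C increments it and an element of R decrements it,
  -- the counter never becomes negative and it ends at e₂.
  data Ballot : ℕ → ℕ → Subset n → Subset n → Set where
    []      : Ballot e e [] []
    both    : {R C : Subset n} → Ballot e₁ e₂ R C → Ballot e₁ e₂ (inside ∷ R) (inside ∷ C)
    neither : {R C : Subset n} → Ballot e₁ e₂ R C → Ballot e₁ e₂ (outside ∷ R) (outside ∷ C)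
    row     : {R C : Subset n} → Ballot e₁ e₂ R C → Ballot (suc e₁) e₂ (inside ∷ R) (outside ∷ C)
    column  : {R C : Subset n} → Ballot (suc e₁) e₂ R C → Ballot e₁ e₂ (outside ∷ R) (inside ∷ C)

  ballot-++ : {R C : Subset n} {R′ C′ : Subset m} {e₃ : ℕ} →
              Ballot e₁ e₂ R C → Ballot e₂ e₃ R′ C′ → Ballot e₁ e₃ (R ++ R′) (C ++ C′)
  ballot-++ [] b′ = b′
  ballot-++ (both b) b′ = both (ballot-++ b b′)
  ballot-++ (neither b) b′ = neither (ballot-++ b b′)
  ballot-++ (row b) b′ = row (ballot-++ b b′)
  ballot-++ (column b) b′ = column (ballot-++ b b′)

  ballot-∣∣ : {R C : Subset n} → Ballot e₁ e₂ R C → ∣ C ∣ + e₁ ≡ ∣ R ∣ + e₂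
  ballot-∣∣ [] = refl
  ballot-∣∣ (both b) = cong suc (ballot-∣∣ b)
  ballot-∣∣ (neither b) = ballot-∣∣ b
  ballot-∣∣ (row b) = trans (ℕ.+-suc _ _) (cong suc (ballot-∣∣ b))
  ballot-∣∣ (column b) = trans (sym (ℕ.+-suc _ _)) (ballot-∣∣ b)

  ballot-enumerate : {R C : Subset n} → Ballot e₁ e₂ R C →
                     (a : Fin ∣ C ∣) (b : Fin ∣ R ∣) → toℕ b ≡ toℕ a + e₁ →
                     enumerate C a Fin.≤ enumerate R b
  ballot-enumerate (both B) zero b _ = z≤n
  ballot-enumerate (both B) (suc a) (suc b) eq = s≤s (ballot-enumerate B a b (ℕ.suc-injective eq))
  ballot-enumerate (neither B) a b eq = s≤s (ballot-enumerate B a b eq)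
  ballot-enumerate {e₁ = suc e₁} (row B) a (suc b) eq =
    s≤s (ballot-enumerate B a b (ℕ.suc-injective (trans eq (ℕ.+-suc (toℕ a) e₁))))
  ballot-enumerate {e₁ = suc e₁} (row B) a zero eq with () ← trans eq (ℕ.+-suc (toℕ a) e₁)
  ballot-enumerate (column B) zero b _ = z≤n
  ballot-enumerate {e₁ = e₁} (column B) (suc a) b eq =
    s≤s (ballot-enumerate B a b (trans eq (sym (ℕ.+-suc (toℕ a) e₁))))

  initial : (m c : ℕ) → Subset m
  initial zero c = []
  initial (suc m) zero = outside ∷ initial m zero
  initial (suc m) (suc c) = inside ∷ initial m c

  initial-ballot : ∀ {m c d} → c ≤ m → d ≤ m → e₁ + d ≡ e₂ + c → Ballot e₁ e₂ (initial m c) (initial m d)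
  initial-ballot {e₁} {e₂} {zero} z≤n z≤n eq
    with refl ← trans (sym (ℕ.+-identityʳ e₁)) (trans eq (ℕ.+-identityʳ e₂)) = []
  initial-ballot {m = suc m} {zero} {zero} _ _ eq = neither (initial-ballot z≤n z≤n eq)
  initial-ballot {e₁} {e₂} {suc m} {suc c} {suc d} (s≤s c≤m) (s≤s d≤m) eq =
    both (initial-ballot c≤m d≤m (ℕ.suc-injective (trans (sym (ℕ.+-suc e₁ d)) (trans eq (ℕ.+-suc e₂ c)))))
  initial-ballot {zero} {e₂} {suc m} {suc c} {zero} _ _ eq with () ← trans eq (ℕ.+-suc e₂ c)
  initial-ballot {suc e₁} {e₂} {suc m} {suc c} {zero} (s≤s c≤m) _ eq =
    row (initial-ballot c≤m z≤n (ℕ.suc-injective (trans eq (ℕ.+-suc e₂ c))))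
  initial-ballot {e₁} {e₂} {suc m} {zero} {suc d} _ (s≤s d≤m) eq =
    column (initial-ballot z≤n d≤m (trans (sym (ℕ.+-suc e₁ d)) eq))

  initial-∈⁻ : ∀ c {p : Fin m} → p ∈ initial m c → toℕ p < c
  initial-∈⁻ {suc m} (suc c) here = s≤s z≤n
  initial-∈⁻ {suc m} (suc c) (there p∈) = s≤s (initial-∈⁻ c p∈)
  initial-∈⁻ {suc m} zero (there p∈) with () ← initial-∈⁻ zero p∈

  initial-∈⁺ : ∀ c (p : Fin m) → toℕ p < c → p ∈ initial m c
  initial-∈⁺ (suc c) zero _ = here
  initial-∈⁺ (suc c) (suc p) (s≤s p<c) = there (initial-∈⁺ c p p<c)

  ∈-concat⁺ : (f : Fin n → Subset m) {b : Fin n} {p : Fin m} → p ∈ f b → combine b p ∈ concat (tabulate f)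
  ∈-concat⁺ f {b} {p} p∈ = lookup⇒[]= (combine b p) (concat (tabulate f))
    (trans (lookup-concat (tabulate f) b p) (trans (cong (λ v → lookup v p) (lookup∘tabulate f b)) ([]=⇒lookup p∈)))

  ∈-concat⁻ : (f : Fin n → Subset m) {b : Fin n} {p : Fin m} → combine b p ∈ concat (tabulate f) → p ∈ f b
  ∈-concat⁻ f {b} {p} k∈ = lookup⇒[]= p (f b) (trans
    (sym (trans (lookup-concat (tabulate f) b p) (cong (λ v → lookup v p) (lookup∘tabulate f b))))
    ([]=⇒lookup k∈))

module LinearAlgebra {c ℓ} (F : FiniteField c ℓ) where
  open FiniteField F hiding (zero) renaming (refl to ≈-refl; sym to ≈-sym; trans to ≈-trans)
  open import Algebra.Properties.Ring ring
    using (-0#≈0#; -‿+-comm; -‿distribʳ-*; -‿involutive; x+x≈x⇒x≈0; +-inverseʳ-unique; -1*x≈-x; x[y-z]≈xy-xz)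
  open import Algebra.Properties.CommutativeMonoid.Sum +-commutativeMonoid
    using (sum; sum-cong-≋; sum-replicate-zero; ∑-distrib-+; sum-remove)
  open import Algebra.Properties.Semiring.Sum semiring using (*-distribˡ-sum)
  open import Algebra.Properties.CommutativeSemigroup *-commutativeSemigroup using (x∙yz≈y∙xz)
  open import Data.Vec.Functional using (updateAt)
  open import Data.Vec.Functional.Properties using (updateAt-updates; updateAt-minimal; updateAt-commutes; updateAt-id-local)
  open import Relation.Binary.Reasoning.Setoid setoid
  open Ballots using (Ballot; ballot-∣∣; ballot-enumerate; enumerate; enumerate-∈; enumerate-surjective; enumerate-mono-<)

  ∑≈sum : ∀ {k} (f : Fin k → Carrier) → ∑ F f ≈ sum f
  ∑≈sum {zero} f = ≈-refl
  ∑≈sum {suc k} f = +-congˡ (∑≈sum (λ i → f (suc i)))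

  ∑-cong : ∀ {k} {f g : Fin k → Carrier} → (∀ i → f i ≈ g i) → ∑ F f ≈ ∑ F g
  ∑-cong {f = f} {g} f≈g = begin
    ∑ F f ≈⟨ ∑≈sum f ⟩
    sum f ≈⟨ sum-cong-≋ f≈g ⟩
    sum g ≈⟨ ∑≈sum g ⟨
    ∑ F g ∎

  ∑-zero : ∀ {k} {f : Fin k → Carrier} → (∀ i → f i ≈ 0#) → ∑ F f ≈ 0#
  ∑-zero {k} f≈0 = ≈-trans (∑-cong f≈0) (≈-trans (∑≈sum {k} (λ _ → 0#)) (sum-replicate-zero k))

  ∑-distrib-+′ : ∀ {k} (f g : Fin k → Carrier) → ∑ F (λ i → f i + g i) ≈ ∑ F f + ∑ F g
  ∑-distrib-+′ f g = begin
    ∑ F (λ i → f i + g i) ≈⟨ ∑≈sum (λ i → f i + g i) ⟩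
    sum (λ i → f i + g i) ≈⟨ ∑-distrib-+ f g ⟩
    sum f + sum g         ≈⟨ +-cong (∑≈sum f) (∑≈sum g) ⟨
    ∑ F f + ∑ F g         ∎

  ∑-*ˡ : ∀ {k} α (f : Fin k → Carrier) → ∑ F (λ i → α * f i) ≈ α * ∑ F f
  ∑-*ˡ α f = begin
    ∑ F (λ i → α * f i) ≈⟨ ∑≈sum (λ i → α * f i) ⟩
    sum (λ i → α * f i) ≈⟨ *-distribˡ-sum α f ⟨
    α * sum f           ≈⟨ *-congˡ (∑≈sum f) ⟨
    α * ∑ F f           ∎

  ∑-single : ∀ {k} (f : Fin k → Carrier) j → (∀ i → i ≢ j → f i ≈ 0#) → ∑ F f ≈ f j
  ∑-single {suc k} f j f≈0 = begin
    ∑ F f                          ≈⟨ ∑≈sum f ⟩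
    sum f                          ≈⟨ sum-remove {i = j} f ⟩
    f j + sum (λ i → f (punchIn j i))
      ≈⟨ +-congˡ (≈-trans (≈-sym (∑≈sum (λ i → f (punchIn j i)))) (∑-zero (λ i → f≈0 _ (Fin.punchInᵢ≢i j i)))) ⟩
    f j + 0#                       ≈⟨ +-identityʳ (f j) ⟩
    f j                            ∎

  ∑-neg : ∀ {k} (f : Fin k → Carrier) → ∑ F (λ i → - f i) ≈ - ∑ F f
  ∑-neg f = begin
    ∑ F (λ i → - f i)      ≈⟨ ∑-cong (λ i → -1*x≈-x (f i)) ⟨
    ∑ F (λ i → - 1# * f i) ≈⟨ ∑-*ˡ (- 1#) f ⟩
    - 1# * ∑ F f           ≈⟨ -1*x≈-x (∑ F f) ⟩
    - ∑ F f                ∎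

  mulV-− : ∀ {t} (M : Matrix F t) (u w : Fin t → Carrier) k →
           mulV F M (λ j → u j - w j) k ≈ mulV F M u k - mulV F M w k
  mulV-− M u w k = begin
    ∑ F (λ j → M k j * (u j - w j))
      ≈⟨ ∑-cong (λ j → x[y-z]≈xy-xz (M k j) (u j) (w j)) ⟩
    ∑ F (λ j → M k j * u j + - (M k j * w j))
      ≈⟨ ∑-distrib-+′ (λ j → M k j * u j) (λ j → - (M k j * w j)) ⟩
    ∑ F (λ j → M k j * u j) + ∑ F (λ j → - (M k j * w j))
      ≈⟨ +-congˡ (∑-neg (λ j → M k j * w j)) ⟩
    mulV F M u k - mulV F M w k ∎

  ∑-cancel-adjacent : ∀ {k} (f : Fin k → Carrier) (a b : Fin k) → toℕ b ≡ suc (toℕ a) →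
                      f a + f b ≈ 0# → (∀ i → i ≢ a → i ≢ b → f i ≈ 0#) → ∑ F f ≈ 0#
  ∑-cancel-adjacent f zero (suc zero) refl fa+fb≈0 f≈0 = begin
    f zero + (f (suc zero) + ∑ F (λ i → f (suc (suc i))))
      ≈⟨ +-assoc _ _ _ ⟨
    (f zero + f (suc zero)) + ∑ F (λ i → f (suc (suc i)))
      ≈⟨ +-cong fa+fb≈0 (∑-zero (λ i → f≈0 (suc (suc i)) (λ ()) (λ ()))) ⟩
    0# + 0#
      ≈⟨ +-identityˡ 0# ⟩
    0# ∎
  ∑-cancel-adjacent f (suc a) (suc b) b≡1+a fa+fb≈0 f≈0 =
    ≈-trans (+-cong (f≈0 zero (λ ()) (λ ()))
                    (∑-cancel-adjacent (λ i → f (suc i)) a b (ℕ.suc-injective b≡1+a) fa+fb≈0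
                       (λ i i≢a i≢b → f≈0 (suc i) (i≢a ∘ Fin.suc-injective) (i≢b ∘ Fin.suc-injective))))
            (+-identityˡ 0#)

  ∑-subset : ∀ {k} (p : Subset k) (f : Fin k → Carrier) → (∀ i → i ∉ p → f i ≈ 0#) →
             ∑ F f ≈ ∑ F (λ a → f (enumerate p a))
  ∑-subset [] f _ = ≈-refl
  ∑-subset (inside ∷ p) f f≈0 = +-congˡ (∑-subset p (f ∘ suc) (λ i i∉p → f≈0 (suc i) (i∉p ∘ drop-there)))
  ∑-subset (outside ∷ p) f f≈0 = ≈-trans
    (+-cong (f≈0 zero (λ ())) (∑-subset p (f ∘ suc) (λ i i∉p → f≈0 (suc i) (i∉p ∘ drop-there))))
    (+-identityˡ _)

  negPow-cong : ∀ k {x y} → x ≈ y → negPow F k x ≈ negPow F k y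
  negPow-cong zero x≈y = x≈y
  negPow-cong (suc k) x≈y = -‿cong (negPow-cong k x≈y)

  negPow-zero : ∀ k {x} → x ≈ 0# → negPow F k x ≈ 0#
  negPow-zero zero x≈0 = x≈0
  negPow-zero (suc k) x≈0 = ≈-trans (-‿cong (negPow-zero k x≈0)) -0#≈0#

  negPow-linear : ∀ k α x y → negPow F k (α * x + y) ≈ α * negPow F k x + negPow F k y
  negPow-linear zero α x y = ≈-refl
  negPow-linear (suc k) α x y = begin
    - negPow F k (α * x + y)                 ≈⟨ -‿cong (negPow-linear k α x y) ⟩
    - (α * negPow F k x + negPow F k y)       ≈⟨ -‿+-comm _ _ ⟨
    - (α * negPow F k x) + - negPow F k y     ≈⟨ +-congʳ (-‿distribʳ-* α _) ⟩
    α * - negPow F k x + - negPow F k y       ∎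

  minor : ∀ {t} → Fin (suc t) → Matrix F (suc t) → Matrix F t
  minor j M a b = M (suc a) (punchIn j b)

  laplaceTerm : ∀ {t} → Matrix F (suc t) → Fin (suc t) → Carrier
  laplaceTerm M j = negPow F (toℕ j) (M zero j * det F (minor j M))

  det-cong : ∀ {t} {M N : Matrix F t} → (∀ a b → M a b ≈ N a b) → det F M ≈ det F N
  det-cong {zero} _ = ≈-refl
  det-cong {suc t} M≈N = ∑-cong λ j →
    negPow-cong (toℕ j) (*-cong (M≈N zero j) (det-cong (λ a b → M≈N (suc a) (punchIn j b))))

  punchIn≢ : ∀ {t} {j c : Fin (suc t)} (j≢c : j ≢ c) {b} → b ≢ Fin.punchOut j≢c → punchIn j b ≢ c
  punchIn≢ j≢c b≢c′ eq = b≢c′ (Fin.punchIn-injective _ _ _ (trans eq (sym (Fin.punchIn-punchOut j≢c))))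

  det-linear : ∀ {t} (c : Fin t) α {M N P : Matrix F t} →
               (∀ a b → b ≢ c → M a b ≈ P a b) → (∀ a b → b ≢ c → N a b ≈ P a b) →
               (∀ a → P a c ≈ α * M a c + N a c) → det F P ≈ α * det F M + det F N
  det-linear {suc t} c α {M} {N} {P} M≈P N≈P Pc≈ = begin
    ∑ F (laplaceTerm P)
      ≈⟨ ∑-cong term ⟩
    ∑ F (λ j → α * laplaceTerm M j + laplaceTerm N j)
      ≈⟨ ∑-distrib-+′ (λ j → α * laplaceTerm M j) (laplaceTerm N) ⟩
    ∑ F (λ j → α * laplaceTerm M j) + ∑ F (laplaceTerm N)
      ≈⟨ +-congʳ (∑-*ˡ α (laplaceTerm M)) ⟩
    α * det F M + det F N ∎
    where
    entry : ∀ j → P zero j * det F (minor j P) ≈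
                  α * (M zero j * det F (minor j M)) + N zero j * det F (minor j N)
    entry j with j Fin.≟ c
    ... | yes refl = begin
      P zero j * dP
        ≈⟨ *-congʳ (Pc≈ zero) ⟩
      (α * M zero j + N zero j) * dP
        ≈⟨ distribʳ dP _ _ ⟩
      α * M zero j * dP + N zero j * dP
        ≈⟨ +-cong (≈-trans (*-assoc _ _ _) (*-congˡ (*-congˡ (minor-≈ M≈P)))) (*-congˡ (minor-≈ N≈P)) ⟩
      α * (M zero j * det F (minor j M)) + N zero j * det F (minor j N) ∎
      where
      dP : Carrier
      dP = det F (minor j P)
      minor-≈ : ∀ {Q} → (∀ a b → b ≢ j → Q a b ≈ P a b) → dP ≈ det F (minor j Q)
      minor-≈ Q≈P = det-cong (λ a b → ≈-sym (Q≈P (suc a) (punchIn j b) (Fin.punchInᵢ≢i j b)))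
    ... | no j≢c = begin
      P zero j * det F (minor j P)
        ≈⟨ *-cong (≈-sym (M≈P zero j j≢c))
                  (det-linear (Fin.punchOut j≢c) α (minor-off M≈P) (minor-off N≈P) minor-at) ⟩
      M zero j * (α * det F (minor j M) + det F (minor j N))
        ≈⟨ distribˡ _ _ _ ⟩
      M zero j * (α * det F (minor j M)) + M zero j * det F (minor j N)
        ≈⟨ +-cong (x∙yz≈y∙xz _ _ _) (*-congʳ (≈-trans (M≈P zero j j≢c) (≈-sym (N≈P zero j j≢c)))) ⟩
      α * (M zero j * det F (minor j M)) + N zero j * det F (minor j N) ∎
      where
      minor-off : ∀ {Q} → (∀ a b → b ≢ c → Q a b ≈ P a b) →
                  ∀ a b → b ≢ Fin.punchOut j≢c → minor j Q a b ≈ minor j P a b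
      minor-off Q≈P a b b≢c′ = Q≈P (suc a) (punchIn j b) (punchIn≢ j≢c b≢c′)
      minor-at : ∀ a → minor j P a (Fin.punchOut j≢c) ≈
                       α * minor j M a (Fin.punchOut j≢c) + minor j N a (Fin.punchOut j≢c)
      minor-at a = subst (λ z → P (suc a) z ≈ α * M (suc a) z + N (suc a) z)
                         (sym (Fin.punchIn-punchOut j≢c)) (Pc≈ (suc a))
    term : ∀ j → laplaceTerm P j ≈ α * laplaceTerm M j + laplaceTerm N j
    term j = ≈-trans (negPow-cong (toℕ j) (entry j)) (negPow-linear (toℕ j) α _ _)

  det-zero-column : ∀ {t} {M : Matrix F t} c → (∀ a → M a c ≈ 0#) → det F M ≈ 0#
  det-zero-column {M = M} c Mc≈0 = x+x≈x⇒x≈0 (det F M) (≈-sym (≈-trans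
    (det-linear c 1# (λ _ _ _ → ≈-refl) (λ _ _ _ → ≈-refl) column) (+-congʳ (*-identityˡ _))))
    where
    column : ∀ a → M a c ≈ 1# * M a c + M a c
    column a = ≈-trans (Mc≈0 a)
      (≈-sym (≈-trans (+-cong (≈-trans (*-identityˡ _) (Mc≈0 a)) (Mc≈0 a)) (+-identityʳ 0#)))

  replaceColumn : ∀ {t} → Matrix F t → Fin t → (Fin t → Carrier) → Matrix F t
  replaceColumn M j u a = updateAt (M a) j (λ _ → u a)

  replaceColumn-at : ∀ {t} (M : Matrix F t) j u a → replaceColumn M j u a j ≡ u a
  replaceColumn-at M j u a = updateAt-updates j (M a)

  replaceColumn-off : ∀ {t} (M : Matrix F t) j u a {b} → b ≢ j → replaceColumn M j u a b ≡ M a b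
  replaceColumn-off M j u a {b} b≢j = updateAt-minimal b j (M a) b≢j

  replaceColumn-agree : ∀ {t} (M : Matrix F t) j u w a b → b ≢ j → replaceColumn M j u a b ≈ replaceColumn M j w a b
  replaceColumn-agree M j u w a b b≢j =
    reflexive (trans (replaceColumn-off M j u a b≢j) (sym (replaceColumn-off M j w a b≢j)))

  det-replaceColumn-∑ : ∀ {t k} (M : Matrix F t) j (α : Fin k → Carrier) (w : Fin k → Fin t → Carrier) →
                        det F (replaceColumn M j (λ a → ∑ F (λ q → α q * w q a))) ≈
                        ∑ F (λ q → α q * det F (replaceColumn M j (w q)))
  det-replaceColumn-∑ {k = zero} M j α w = det-zero-column j (λ a → reflexive (replaceColumn-at M j _ a))
  det-replaceColumn-∑ {k = suc k} M j α w = ≈-trans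
    (det-linear j (α zero) (replaceColumn-agree M j _ _) (replaceColumn-agree M j _ _) column)
    (+-congˡ (det-replaceColumn-∑ M j (λ q → α (suc q)) (λ q → w (suc q))))
    where
    rest : Fin _ → Carrier
    rest a = ∑ F (λ q → α (suc q) * w (suc q) a)
    column : ∀ a → replaceColumn M j (λ b → α zero * w zero b + rest b) a j ≈
                   α zero * replaceColumn M j (w zero) a j + replaceColumn M j rest a j
    column a = reflexive (trans (replaceColumn-at M j (λ b → α zero * w zero b + rest b) a)
      (sym (cong₂ (λ x y → α zero * x + y) (replaceColumn-at M j (w zero) a) (replaceColumn-at M j rest a))))

  punchIn-adjacent : ∀ {t} {a b : Fin (suc t)} → toℕ b ≡ suc (toℕ a) → ∀ i →
                     punchIn a i ≡ punchIn b i ⊎ (punchIn a i ≡ b × punchIn b i ≡ a)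
  punchIn-adjacent {a = zero} {suc zero} refl zero = inj₂ (refl , refl)
  punchIn-adjacent {a = zero} {suc zero} refl (suc i) = inj₁ refl
  punchIn-adjacent {a = suc a} {suc b} b≡1+a zero = inj₁ refl
  punchIn-adjacent {a = suc a} {suc b} b≡1+a (suc i) =
    Sum.map (cong suc) (Product.map (cong suc) (cong suc)) (punchIn-adjacent (ℕ.suc-injective b≡1+a) i)

  punchIn-adjacent⁻ : ∀ {t} (j : Fin (suc t)) (a b : Fin t) →
                      toℕ (punchIn j b) ≡ suc (toℕ (punchIn j a)) → toℕ b ≡ suc (toℕ a)
  punchIn-adjacent⁻ zero a b eq = ℕ.suc-injective eq
  punchIn-adjacent⁻ (suc j) zero zero ()
  punchIn-adjacent⁻ (suc j) zero (suc zero) _ = refl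
  punchIn-adjacent⁻ (suc zero) zero (suc (suc b)) ()
  punchIn-adjacent⁻ (suc (suc j)) zero (suc (suc b)) ()
  punchIn-adjacent⁻ (suc j) (suc a) zero ()
  punchIn-adjacent⁻ (suc j) (suc a) (suc b) eq = cong suc (punchIn-adjacent⁻ j a b (ℕ.suc-injective eq))

  det-adjacent-equal : ∀ {t} {M : Matrix F t} (a b : Fin t) → toℕ b ≡ suc (toℕ a) →
                       (∀ x → M x a ≈ M x b) → det F M ≈ 0#
  det-adjacent-equal {suc t} {M} a b b≡1+a Ma≈Mb = ∑-cancel-adjacent (laplaceTerm M) a b b≡1+a cancel others
    where
    minors-equal : ∀ x i → minor b M x i ≈ minor a M x i
    minors-equal x i with punchIn-adjacent b≡1+a i
    ... | inj₁ eq = reflexive (cong (M (suc x)) (sym eq))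
    ... | inj₂ (eqa , eqb) = subst₂ (λ p q → M (suc x) q ≈ M (suc x) p) (sym eqa) (sym eqb) (Ma≈Mb (suc x))
    X : Carrier
    X = M zero a * det F (minor a M)
    cancel : laplaceTerm M a + laplaceTerm M b ≈ 0#
    cancel = ≈-trans
      (+-congˡ (subst (λ k → negPow F k (M zero b * det F (minor b M)) ≈ - negPow F (toℕ a) X) (sym b≡1+a)
                      (-‿cong (negPow-cong (toℕ a) (*-cong (≈-sym (Ma≈Mb zero)) (det-cong minors-equal))))))
      (-‿inverseʳ _)
    others : ∀ j → j ≢ a → j ≢ b → laplaceTerm M j ≈ 0#
    others j j≢a j≢b = negPow-zero (toℕ j) (≈-trans (*-congˡ (det-adjacent-equal _ _ adjacent columns)) (zeroʳ _))
      where
      adjacent : toℕ (Fin.punchOut j≢b) ≡ suc (toℕ (Fin.punchOut j≢a))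
      adjacent = punchIn-adjacent⁻ j _ _ (trans (cong toℕ (Fin.punchIn-punchOut j≢b))
                   (trans b≡1+a (cong (suc ∘ toℕ) (sym (Fin.punchIn-punchOut j≢a)))))
      columns : ∀ x → minor j M x (Fin.punchOut j≢a) ≈ minor j M x (Fin.punchOut j≢b)
      columns x = subst₂ (λ p q → M (suc x) p ≈ M (suc x) q)
                    (sym (Fin.punchIn-punchOut j≢a)) (sym (Fin.punchIn-punchOut j≢b)) (Ma≈Mb (suc x))

  det-replaceColumn-+ : ∀ {t} (M : Matrix F t) j u w →
                        det F (replaceColumn M j (λ x → u x + w x)) ≈
                        det F (replaceColumn M j u) + det F (replaceColumn M j w)
  det-replaceColumn-+ M j u w = ≈-trans
    (det-linear j 1# (replaceColumn-agree M j u _) (replaceColumn-agree M j w _) column)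
    (+-congʳ (*-identityˡ _))
    where
    column : ∀ x → replaceColumn M j (λ y → u y + w y) x j ≈ 1# * replaceColumn M j u x j + replaceColumn M j w x j
    column x = ≈-trans (reflexive (trans (replaceColumn-at M j (λ y → u y + w y) x)
                 (sym (cong₂ _+_ (replaceColumn-at M j u x) (replaceColumn-at M j w x)))))
               (+-congʳ (≈-sym (*-identityˡ _)))

  swapColumns : ∀ {t} → Matrix F t → Fin t → Fin t → Matrix F t
  swapColumns M a b = replaceColumn (replaceColumn M a (λ x → M x b)) b (λ x → M x a)

  det-swap-adjacent : ∀ {t} (M : Matrix F t) (a b : Fin t) → toℕ b ≡ suc (toℕ a) →
                      det F (swapColumns M a b) ≈ - det F M
  det-swap-adjacent M a b b≡1+a = +-inverseʳ-unique (det F M) _ (begin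
    det F M + det F (N B A)
      ≈⟨ +-cong (+-identityˡ _) (+-identityʳ _) ⟨
    (0# + det F M) + (det F (N B A) + 0#)
      ≈⟨ +-cong (+-cong (equal A) (det-cong (λ x c → reflexive (N-A-B x c)))) (+-congˡ (equal B)) ⟨
    (det F (N A A) + det F (N A B)) + (det F (N B A) + det F (N B B))
      ≈⟨ +-cong (det-replaceColumn-+ _ b A B) (det-replaceColumn-+ _ b A B) ⟨
    det F (N A S) + det F (N B S)
      ≈⟨ additive-at-a S ⟨
    det F (N S S)
      ≈⟨ equal S ⟩
    0# ∎)
    where
    a≢b : a ≢ b
    a≢b refl = ℕ.1+n≢n (sym b≡1+a)
    A B S : Fin _ → Carrier
    A x = M x a
    B x = M x b
    S x = A x + B x
    N : (Fin _ → Carrier) → (Fin _ → Carrier) → Matrix F _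
    N u w = replaceColumn (replaceColumn M a u) b w
    N-at-a : ∀ u w x → N u w x a ≡ u x
    N-at-a u w x = trans (replaceColumn-off (replaceColumn M a u) b w x a≢b) (replaceColumn-at M a u x)
    equal : ∀ u → det F (N u u) ≈ 0#
    equal u = det-adjacent-equal a b b≡1+a
      (λ x → reflexive (trans (N-at-a u u x) (sym (replaceColumn-at (replaceColumn M a u) b u x))))
    N-A-B : ∀ x c → N A B x c ≡ M x c
    N-A-B x c = trans (updateAt-id-local b _ (sym (updateAt-id-local a (M x) refl b)) c)
                      (updateAt-id-local a (M x) refl c)
    additive-at-a : ∀ w → det F (N S w) ≈ det F (N A w) + det F (N B w)
    additive-at-a w = begin
      det F (N S w)  ≈⟨ det-cong (λ x c → reflexive (commute S x c)) ⟩
      det F (replaceColumn (replaceColumn M b w) a S) ≈⟨ det-replaceColumn-+ _ a A B ⟩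
      det F (replaceColumn (replaceColumn M b w) a A) + det F (replaceColumn (replaceColumn M b w) a B)
        ≈⟨ +-cong (det-cong (λ x c → reflexive (commute A x c))) (det-cong (λ x c → reflexive (commute B x c))) ⟨
      det F (N A w) + det F (N B w) ∎
      where
      commute : ∀ u x c → N u w x c ≡ replaceColumn (replaceColumn M b w) a u x c
      commute u x = updateAt-commutes b a (a≢b ∘ sym) (M x)

  det-equal-columns-gap : ∀ {t} k {M : Matrix F t} (a b : Fin t) → toℕ b ≡ suc (toℕ a ℕ.+ k) →
                          (∀ x → M x a ≈ M x b) → det F M ≈ 0#
  det-equal-columns-gap zero a b b≡1+a+0 Ma≈Mb =
    det-adjacent-equal a b (trans b≡1+a+0 (cong suc (ℕ.+-identityʳ (toℕ a)))) Ma≈Mb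
  det-equal-columns-gap (suc k) {M} a (suc b) b≡1+a+k Ma≈Mb = begin
    det F M            ≈⟨ -‿involutive (det F M) ⟨
    - - det F M        ≈⟨ -‿cong (det-swap-adjacent M p q (cong suc (sym (Fin.toℕ-inject₁ b)))) ⟨
    - det F M′         ≈⟨ -‿cong (det-equal-columns-gap k {M′} a p p≡1+a+k M′a≈M′p) ⟩
    - 0#               ≈⟨ -0#≈0# ⟩
    0#                 ∎
    where
    p q : Fin _
    p = Fin.inject₁ b
    q = suc b
    K M′ : Matrix F _
    K = replaceColumn M p (λ x → M x q)
    M′ = swapColumns M p q
    p≡1+a+k : toℕ p ≡ suc (toℕ a ℕ.+ k)
    p≡1+a+k = trans (Fin.toℕ-inject₁ b) (trans (ℕ.suc-injective b≡1+a+k) (ℕ.+-suc (toℕ a) k))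
    a<p : a Fin.< p
    a<p = subst (toℕ a ℕ.<_) (sym p≡1+a+k) (s≤s (ℕ.m≤m+n (toℕ a) k))
    p<q : p Fin.< q
    p<q = ℕ.≤-reflexive (cong suc (Fin.toℕ-inject₁ b))
    M′a≈M′p : ∀ x → M′ x a ≈ M′ x p
    M′a≈M′p x = begin
      M′ x a  ≡⟨ trans (replaceColumn-off K q (λ y → M y p) x (Fin.<⇒≢ (ℕ.<-trans a<p p<q)))
                       (replaceColumn-off M p (λ y → M y q) x (Fin.<⇒≢ a<p)) ⟩
      M x a   ≈⟨ Ma≈Mb x ⟩
      M x q   ≡⟨ trans (replaceColumn-off K q (λ y → M y p) x (Fin.<⇒≢ p<q))
                       (replaceColumn-at M p (λ y → M y q) x) ⟨
      M′ x p  ∎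

  det-equal-columns : ∀ {t} {M : Matrix F t} (a b : Fin t) → a ≢ b → (∀ x → M x a ≈ M x b) → det F M ≈ 0#
  det-equal-columns a b a≢b Ma≈Mb with ℕ.<-cmp (toℕ a) (toℕ b)
  ... | tri< a<b _ _ = det-equal-columns-gap _ a b (sym (ℕ.m+[n∸m]≡n a<b)) Ma≈Mb
  ... | tri≈ _ a≡b _ = contradiction (Fin.toℕ-injective a≡b) a≢b
  ... | tri> _ _ b<a = det-equal-columns-gap _ b a (sym (ℕ.m+[n∸m]≡n b<a)) (≈-sym ∘ Ma≈Mb)

  det-kernel : ∀ {t} (M : Matrix F t) (v : Fin t → Carrier) → (∀ x → mulV F M v x ≈ 0#) →
               ∀ j → v j * det F M ≈ 0#
  det-kernel M v Mv≈0 j = begin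
    v j * det F M
      ≈⟨ *-congˡ (det-cong (λ x c → reflexive (updateAt-id-local j (M x) refl c))) ⟨
    v j * det F (replaceColumn M j (column j))
      ≈⟨ ∑-single (λ k → v k * det F (replaceColumn M j (column k))) j other ⟨
    ∑ F (λ k → v k * det F (replaceColumn M j (column k)))
      ≈⟨ det-replaceColumn-∑ M j v column ⟨
    det F (replaceColumn M j (λ x → ∑ F (λ k → v k * M x k)))
      ≈⟨ det-zero-column j zero-column ⟩
    0# ∎
    where
    column : Fin _ → Fin _ → Carrier
    column k x = M x k
    other : ∀ k → k ≢ j → v k * det F (replaceColumn M j (column k)) ≈ 0#
    other k k≢j = ≈-trans (*-congˡ (det-equal-columns j k (k≢j ∘ sym) (λ x → reflexive
                    (trans (replaceColumn-at M j (column k) x) (sym (replaceColumn-off M j (column k) x k≢j))))))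
                  (zeroʳ _)
    zero-column : ∀ x → replaceColumn M j (λ y → ∑ F (λ k → v k * M y k)) x j ≈ 0#
    zero-column x = ≈-trans (reflexive (replaceColumn-at M j (λ y → ∑ F (λ k → v k * M y k)) x))
                            (≈-trans (∑-cong (λ k → *-comm (v k) (M x k))) (Mv≈0 x))

  nonSingular-kernel : ∀ {t} (M : Matrix F t) → NonSingular F M → (v : Fin t → Carrier) →
                       (∀ x → mulV F M v x ≈ 0#) → ∀ j → v j ≈ 0#
  nonSingular-kernel M det≉0 v Mv≈0 j with d⁻¹ , d*d⁻¹≈1 ← inverse (det F M) det≉0 = begin
    v j                    ≈⟨ *-identityʳ (v j) ⟨
    v j * 1#               ≈⟨ *-congˡ d*d⁻¹≈1 ⟨
    v j * (det F M * d⁻¹)  ≈⟨ *-assoc _ _ _ ⟨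
    v j * det F M * d⁻¹    ≈⟨ *-congʳ (det-kernel M v Mv≈0 j) ⟩
    0# * d⁻¹               ≈⟨ zeroˡ d⁻¹ ⟩
    0#                     ∎

  ballot-kernel : ∀ {N} (M : Matrix F N) → TotallyNonSingular F M → {R C : Subset N} → Ballot 0 0 R C →
                  (u : Fin N → Carrier) → (∀ k → k ∉ C → u k ≈ 0#) → (∀ k → k ∈ R → mulV F M u k ≈ 0#) →
                  ∀ k → k ∈ C → u k ≈ 0#
  ballot-kernel M (_ , minor≉0) {R} {C} ballot u u≈0 Mu≈0 k k∈C with a , refl ← enumerate-surjective C k∈C =
    nonSingular-kernel (λ x y → M (I x) (J y)) (minor≉0 ∣ C ∣ 1≤∣C∣ (∣p∣≤n C) I J I↑ J↑ J≤I)
                       (u ∘ J) restricted-kernel a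
    where
    ∣C∣≡∣R∣ : ∣ C ∣ ≡ ∣ R ∣
    ∣C∣≡∣R∣ = trans (sym (ℕ.+-identityʳ _)) (trans (ballot-∣∣ ballot) (ℕ.+-identityʳ _))
    I J : Fin ∣ C ∣ → Fin _
    I = enumerate R ∘ Fin.cast ∣C∣≡∣R∣
    J = enumerate C
    1≤∣C∣ : 1 ℕ.≤ ∣ C ∣
    1≤∣C∣ = ℕ.≤-trans (s≤s z≤n) (Fin.toℕ<n a)
    I↑ : StrictlyIncreasing F I
    I↑ x y x<y =
      enumerate-mono-< R (subst₂ ℕ._<_ (sym (Fin.toℕ-cast ∣C∣≡∣R∣ x)) (sym (Fin.toℕ-cast ∣C∣≡∣R∣ y)) x<y)
    J↑ : StrictlyIncreasing F J
    J↑ x y = enumerate-mono-< C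
    J≤I : ∀ q → toℕ (J q) ℕ.≤ toℕ (I q)
    J≤I q =
      ballot-enumerate ballot q (Fin.cast ∣C∣≡∣R∣ q) (trans (Fin.toℕ-cast ∣C∣≡∣R∣ q) (sym (ℕ.+-identityʳ _)))
    restricted-kernel : ∀ x → mulV F (λ x y → M (I x) (J y)) (u ∘ J) x ≈ 0#
    restricted-kernel x = ≈-trans
      (≈-sym (∑-subset C (λ k → M (I x) k * u k) (λ k k∉C → ≈-trans (*-congˡ (u≈0 k k∉C)) (zeroʳ _))))
      (Mu≈0 (I x) (enumerate-∈ R _))

  topLeft-totallyNonSingular : ∀ {N k} (A : Matrix F N) (k≤N : k ℕ.≤ N) →
                               TotallyNonSingular F A → TotallyNonSingular F (topLeft F A k≤N)
  topLeft-totallyNonSingular A k≤N (lower , minor≉0) =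
    (λ a b a<b → lower (inject≤ a k≤N) (inject≤ b k≤N) (inject≤-preserves ℕ._<_ a<b)) ,
    (λ t 1≤t t≤k I J I↑ J↑ J≤I →
       minor≉0 t 1≤t (ℕ.≤-trans t≤k k≤N) (λ q → inject≤ (I q) k≤N) (λ q → inject≤ (J q) k≤N)
       (λ a b a<b → inject≤-preserves ℕ._<_ (I↑ a b a<b)) (λ a b a<b → inject≤-preserves ℕ._<_ (J↑ a b a<b))
       (λ q → inject≤-preserves ℕ._≤_ (J≤I q)))
    where
    inject≤-preserves : ∀ (_∼_ : ℕ → ℕ → Set) {a b} → toℕ a ∼ toℕ b →
                        toℕ (inject≤ a k≤N) ∼ toℕ (inject≤ b k≤N)
    inject≤-preserves _∼_ {a} {b} = subst₂ _∼_ (sym (Fin.toℕ-inject≤ a k≤N)) (sym (Fin.toℕ-inject≤ b k≤N))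

falses : ∀ {n} → (Fin n → Bool) → ℕ
falses {zero} a = 0
falses {suc n} a = (if a zero then id else suc) (falses (a ∘ suc))

falses-head : ∀ {n} (a : Fin (suc n) → Bool) {h} → a zero ≡ h →
              falses a ≡ (if h then id else suc) (falses (a ∘ suc))
falses-head a refl = refl

falses-suc : ∀ {n} (a : Fin (suc n) → Bool) → falses (a ∘ suc) ℕ.≤ falses a
falses-suc a with a zero
... | true = ℕ.≤-refl
... | false = ℕ.n≤1+n _

module Matching (r s : ℕ) where
  open import Data.Nat using (_+_; _*_; _∸_; _≤_; _<_; _≤?_)
  open import Data.Nat.Solver using (module +-*-Solver)
  open +-*-Solver using (solve; _:+_; _:*_; _:=_; con)
  open import Relation.Binary.PropositionalEquality using (module ≡-Reasoning)
  open Ballots using (Ballot; ballot-++; initial; initial-ballot)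

  -- A block of the flattened matrix has r + s rows and columns; the first s
  -- columns of a block carry the input symbol, the remaining r are padding.
  -- Scanning blocks from the left, `skipping k` skips this block and k more,
  -- `matching e` has e input columns not yet matched with rows of agreeing
  -- output blocks, and `finished` has matched all of them.
  data Phase : Set where
    skipping : ℕ → Phase
    matching : ℕ → Phase
    finished : Phase

  skipFirst : ℕ → Phase
  skipFirst zero = matching 0
  skipFirst (suc l) = skipping l

  matchingStep : ℕ → Bool → Phase
  matchingStep e false = matching (e + s)
  matchingStep e true with e ≤? r
  ... | yes _ = finished
  ... | no _ = matching (e ∸ r)

  matchedRows : ℕ → Bool → ℕ
  matchedRows e false = 0
  matchedRows e true with e ≤? r
  ... | yes _ = e + s
  ... | no _ = r + s

  step : Phase → Bool → Phase
  step (skipping k) _ = skipFirst k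
  step (matching e) agree = matchingStep e agree
  step finished _ = finished

  rows : Phase → Bool → ℕ
  rows (matching e) agree = matchedRows e agree
  rows _ _ = 0

  columns : Phase → ℕ
  columns (matching e) = s
  columns _ = 0

  pending : Phase → ℕ
  pending (matching e) = e
  pending _ = 0

  pending-skipFirst : ∀ l → pending (skipFirst l) ≡ 0
  pending-skipFirst zero = refl
  pending-skipFirst (suc l) = refl

  step-balance : ∀ S agree → pending S + columns S ≡ pending (step S agree) + rows S agree
  step-balance (skipping zero) _ = refl
  step-balance (skipping (suc k)) _ = refl
  step-balance (matching e) false = sym (ℕ.+-identityʳ (e + s))
  step-balance (matching e) true with e ≤? r
  ... | yes _ = refl
  ... | no e≰r = trans (cong (_+ s) (sym (ℕ.m∸n+n≡m (ℕ.<⇒≤ (ℕ.≰⇒> e≰r))))) (ℕ.+-assoc (e ∸ r) r s)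
  step-balance finished _ = refl

  rows-≤ : ∀ S agree → rows S agree ≤ r + s
  rows-≤ (skipping _) _ = z≤n
  rows-≤ (matching e) false = z≤n
  rows-≤ (matching e) true with e ≤? r
  ... | yes e≤r = ℕ.+-monoˡ-≤ s e≤r
  ... | no _ = ℕ.≤-refl
  rows-≤ finished _ = z≤n

  columns-≤ : ∀ S → columns S ≤ r + s
  columns-≤ (skipping _) = z≤n
  columns-≤ (matching _) = ℕ.m≤n+m s r
  columns-≤ finished = z≤n

  rows-positive : ∀ S agree → 0 < rows S agree → T agree × S ≢ finished
  rows-positive (matching e) true _ = _ , λ ()

  phaseAt : ∀ {n} → Phase → (Fin n → Bool) → Fin n → Phase
  phaseAt S agree zero = S
  phaseAt S agree (suc b) = phaseAt (step S (agree zero)) (agree ∘ suc) b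

  finalPhase : ∀ {n} → Phase → (Fin n → Bool) → Phase
  finalPhase {zero} S agree = S
  finalPhase {suc n} S agree = finalPhase (step S (agree zero)) (agree ∘ suc)

  rowSet columnSet : ∀ {n} → Phase → (Fin n → Bool) → Subset (n * (r + s))
  rowSet S agree = concat (tabulate λ b → initial (r + s) (rows (phaseAt S agree b) (agree b)))
  columnSet S agree = concat (tabulate λ b → initial (r + s) (columns (phaseAt S agree b)))

  run-ballot : ∀ {n} S (agree : Fin n → Bool) →
               Ballot (pending S) (pending (finalPhase S agree)) (rowSet S agree) (columnSet S agree)
  run-ballot {zero} S agree = Ballot.[]
  run-ballot {suc n} S agree = ballot-++
    (initial-ballot (rows-≤ S (agree zero)) (columns-≤ S) (step-balance S (agree zero)))
    (run-ballot (step S (agree zero)) (agree ∘ suc))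

  phaseAt-finished : ∀ {n} (agree : Fin n → Bool) b → phaseAt finished agree b ≡ finished
  phaseAt-finished agree zero = refl
  phaseAt-finished agree (suc b) = phaseAt-finished (agree ∘ suc) b

  phaseAt-finished-mono : ∀ {n} S (agree : Fin n → Bool) {b c} → phaseAt S agree b ≡ finished → b Fin.≤ c →
                          phaseAt S agree c ≡ finished
  phaseAt-finished-mono S agree {zero} {c} refl _ = phaseAt-finished agree c
  phaseAt-finished-mono S agree {suc b} {suc c} eq (s≤s b≤c) =
    phaseAt-finished-mono (step S (agree zero)) (agree ∘ suc) eq b≤c

  data Started : Phase → Set where
    matching : ∀ e → Started (matching e)
    finished : Started finished

  step-started : ∀ {S} agree → Started S → Started (step S agree)
  step-started false (matching e) = matching (e + s)
  step-started true (matching e) with e ≤? r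
  ... | yes _ = finished
  ... | no _ = matching (e ∸ r)
  step-started _ finished = finished

  phaseAt-started : ∀ {n S} (agree : Fin n → Bool) b → Started S → Started (phaseAt S agree b)
  phaseAt-started agree zero started = started
  phaseAt-started agree (suc b) started =
    phaseAt-started (agree ∘ suc) b (step-started (agree zero) started)

  finalPhase-started : ∀ {n S} (agree : Fin n → Bool) → Started S → Started (finalPhase S agree)
  finalPhase-started {zero} agree started = started
  finalPhase-started {suc n} agree started =
    finalPhase-started (agree ∘ suc) (step-started (agree zero) started)

  finalPhase-finished : ∀ {n} (agree : Fin n → Bool) → finalPhase finished agree ≡ finished
  finalPhase-finished {zero} agree = refl
  finalPhase-finished {suc n} agree = finalPhase-finished (agree ∘ suc)

  phaseAt-skipFirst : ∀ {n} l (agree : Fin n → Bool) b → toℕ b ≤ l →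
                      phaseAt (skipFirst l) agree b ≡ skipFirst (l ∸ toℕ b)
  phaseAt-skipFirst l agree zero _ = refl
  phaseAt-skipFirst (suc l) agree (suc b) (s≤s b≤l) = phaseAt-skipFirst l (agree ∘ suc) b b≤l

  phaseAt-skipping : ∀ {n} l (agree : Fin n → Bool) b {k} → phaseAt (skipFirst l) agree b ≡ skipping k → toℕ b < l
  phaseAt-skipping (suc l) agree zero _ = s≤s z≤n
  phaseAt-skipping (suc l) agree (suc b) eq = s≤s (phaseAt-skipping l (agree ∘ suc) b eq)
  phaseAt-skipping zero agree (suc b) eq
    with () ← subst Started eq (phaseAt-started (agree ∘ suc) b (step-started (agree zero) (matching 0)))

  finalPhase-skipping : ∀ {n} l (agree : Fin n → Bool) {k} → finalPhase (skipFirst l) agree ≡ skipping k → n ≤ l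
  finalPhase-skipping {zero} l agree _ = z≤n
  finalPhase-skipping {suc n} (suc l) agree eq = s≤s (finalPhase-skipping l (agree ∘ suc) eq)
  finalPhase-skipping {suc n} zero agree eq
    with () ← subst Started eq (finalPhase-started (agree ∘ suc) (step-started (agree zero) (matching 0)))

  -- ef = e + s n − (r + s)(n − falses agree): every block brings s columns and
  -- every agreeing block matches r + s of them; stated here without subtraction.
  matching-run : ∀ {n} e (agree : Fin n → Bool) {ef} → finalPhase (matching e) agree ≡ matching ef → 1 ≤ e →
                 1 ≤ ef × (r + s) * falses agree + e ≡ r * n + ef
  matching-run {zero} e agree refl 1≤e = 1≤e , cong (_+ e) (trans (ℕ.*-zeroʳ (r + s)) (sym (ℕ.*-zeroʳ r)))
  matching-run {suc n} e agree {ef} eq 1≤e with agree zero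
  ... | false with 1≤ef , balance ← matching-run (e + s) (agree ∘ suc) eq (ℕ.≤-trans 1≤e (ℕ.m≤m+n e s)) =
    1≤ef , (begin
      (r + s) * (1 + F) + e
        ≡⟨ solve 4 (λ r s F e → (r :+ s) :* (con 1 :+ F) :+ e := r :+ ((r :+ s) :* F :+ (e :+ s))) refl r s F e ⟩
      r + ((r + s) * F + (e + s))
        ≡⟨ cong (r +_) balance ⟩
      r + (r * n + ef)
        ≡⟨ solve 3 (λ r n ef → r :+ (r :* n :+ ef) := r :* (con 1 :+ n) :+ ef) refl r n ef ⟩
      r * suc n + ef ∎)
    where
    open ≡-Reasoning
    F : ℕ
    F = falses (agree ∘ suc)
  ... | true with e ≤? r
  ...   | yes _ with () ← trans (sym (finalPhase-finished (agree ∘ suc))) eq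
  ...   | no e≰r with 1≤ef , balance ← matching-run (e ∸ r) (agree ∘ suc) eq (ℕ.m<n⇒0<n∸m (ℕ.≰⇒> e≰r)) =
    1≤ef , (begin
      (r + s) * F + e
        ≡⟨ cong ((r + s) * F +_) (sym (ℕ.m∸n+n≡m (ℕ.<⇒≤ (ℕ.≰⇒> e≰r)))) ⟩
      (r + s) * F + (e ∸ r + r)
        ≡⟨ solve 4 (λ x F d r → x :* F :+ (d :+ r) := r :+ (x :* F :+ d)) refl (r + s) F (e ∸ r) r ⟩
      r + ((r + s) * F + (e ∸ r))
        ≡⟨ cong (r +_) balance ⟩
      r + (r * n + ef)
        ≡⟨ solve 3 (λ r n ef → r :+ (r :* n :+ ef) := r :* (con 1 :+ n) :+ ef) refl r n ef ⟩
      r * suc n + ef ∎)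
    where
    open ≡-Reasoning
    F : ℕ
    F = falses (agree ∘ suc)

  skipFirst-run-bound : 1 ≤ s → ∀ {n} l (agree : Fin n → Bool) {ef} → l < n →
                        finalPhase (skipFirst l) agree ≡ matching ef → r * (n ∸ l) < (r + s) * falses agree
  skipFirst-run-bound 1≤s {suc n} (suc l) agree (s≤s l<n) eq = ℕ.<-≤-trans
    (skipFirst-run-bound 1≤s l (agree ∘ suc) l<n eq)
    (ℕ.*-monoʳ-≤ (r + s) (falses-suc agree))
  skipFirst-run-bound 1≤s {suc n} zero agree {ef} _ eq with agree zero
  ... | true with () ← trans (sym (finalPhase-finished (agree ∘ suc))) eq
  ... | false with 1≤ef , balance ← matching-run s (agree ∘ suc) eq 1≤s = begin-strict
    r * suc n
      <⟨ ℕ.m<m+n (r * suc n) 1≤ef ⟩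
    r * suc n + ef
      ≡⟨ solve 3 (λ r n ef → r :* (con 1 :+ n) :+ ef := r :+ (r :* n :+ ef)) refl r n ef ⟩
    r + (r * n + ef)
      ≡⟨ cong (r +_) balance ⟨
    r + ((r + s) * F + s)
      ≡⟨ solve 3 (λ r s F → r :+ ((r :+ s) :* F :+ s) := (r :+ s) :* (con 1 :+ F)) refl r s F ⟩
    (r + s) * (1 + F) ∎
    where
    open ℕ.≤-Reasoning
    F : ℕ
    F = falses (agree ∘ suc)

module TreeCode {c ℓ} (F : FiniteField c ℓ) where
  open FiniteField F hiding (zero) renaming (refl to ≈-refl; sym to ≈-sym; trans to ≈-trans)
  open import Algebra.Properties.Ring ring using (x∙y⁻¹≈ε⇒x≈y; x≈y⇒x∙y⁻¹≈ε)
  open import Relation.Nullary using (Dec; does)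

  does-sound : ∀ {a} {A : Set a} (d : Dec A) → T (does d) → A
  does-sound (yes a) _ = a

  Δ≡falses : ∀ {d k} (u v : Word F d k) → Δ F u v ≡ falses (λ b → does (symEq? F (u b) (v b)))
  Δ≡falses {k = zero} u v = refl
  Δ≡falses {k = suc k} u v with symEq? F (u zero) (v zero) in eq
  ... | yes _ = trans (Δ≡falses (u ∘ suc) (v ∘ suc)) (sym (falses-head agree (cong does eq)))
    where
    agree : Fin (suc k) → Bool
    agree b = does (symEq? F (u b) (v b))
  ... | no _ = trans (cong suc (Δ≡falses (u ∘ suc) (v ∘ suc))) (sym (falses-head agree (cong does eq)))
    where
    agree : Fin (suc k) → Bool
    agree b = does (symEq? F (u b) (v b))

  firstDifference : ∀ {d k} (x y : Word F d k) → ¬ WordEq F x y →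
                    Σ (Fin k) λ L → split F x y ≡ toℕ L ×
                                    (∀ b → toℕ b ℕ.< toℕ L → SymEq F (x b) (y b)) × ¬ SymEq F (x L) (y L)
  firstDifference {k = zero} x y x≉y = contradiction (λ ()) x≉y
  firstDifference {k = suc k} x y x≉y with symEq? F (x zero) (y zero)
  ... | no x₀≉y₀ = zero , refl , (λ _ ()) , x₀≉y₀
  ... | yes x₀≈y₀
    with L , split≡L , before , xL≉yL ← firstDifference (x ∘ suc) (y ∘ suc)
                                          (λ x′≈y′ → x≉y λ { zero → x₀≈y₀ ; (suc b) → x′≈y′ b }) =
    suc L , cong suc split≡L , before′ , xL≉yL
    where
    before′ : ∀ b → toℕ b ℕ.< suc (toℕ L) → SymEq F (x b) (y b)
    before′ zero _ = x₀≈y₀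
    before′ (suc b) (s≤s b<L) = before b b<L

  pad-cong : ∀ r s {v w : Fin s → Carrier} → SymEq F v w → ∀ q → pad F r s v q ≈ pad F r s w q
  pad-cong r s v≈w q with toℕ q ℕ.<? s
  ... | yes _ = v≈w _
  ... | no _ = ≈-refl

  pad-padding : ∀ r s (v : Fin s → Carrier) q → ¬ toℕ q ℕ.< s → pad F r s v q ≈ 0#
  pad-padding r s v q q≮s with toℕ q ℕ.<? s
  ... | yes q<s = contradiction q<s q≮s
  ... | no _ = ≈-refl

  pad-symbol : ∀ r s (v : Fin s → Carrier) p → pad F r s v (inject≤ p (ℕ.m≤n+m s r)) ≈ v p
  pad-symbol r s v p with toℕ (inject≤ p (ℕ.m≤n+m s r)) ℕ.<? s
  ... | yes q<s = reflexive (cong v (Fin.toℕ-injective (trans (Fin.toℕ-fromℕ< q<s) (Fin.toℕ-inject≤ p _))))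
  ... | no q≮s = contradiction (subst (ℕ._< s) (sym (Fin.toℕ-inject≤ p _)) (Fin.toℕ<n p)) q≮s

  flatten-combine : ∀ {d k} (w : Word F d k) b p → flatten F w (combine b p) ≡ w b p
  flatten-combine w b p = cong (λ (bp : Fin _ × Fin _) → w (proj₁ bp) (proj₂ bp)) (Fin.remQuot-combine b p)

  module Distance (r s : ℕ) (1≤s : 1 ℕ.≤ s) {i} (M : Matrix F (i ℕ.* (r ℕ.+ s))) (tns : TotallyNonSingular F M)
                  (x y : Word F s i) (L : Fin i) (x≈y-before-L : ∀ b → toℕ b ℕ.< toℕ L → SymEq F (x b) (y b))
                  (xL≉yL : ¬ SymEq F (x L) (y L)) where
    open Matching r s
    open LinearAlgebra F using (mulV-−; ∑-cong; ballot-kernel)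
    open Ballots using (Ballot; initial; initial-∈⁻; initial-∈⁺; ∈-concat⁺; ∈-concat⁻)
    open import Relation.Binary.Reasoning.Setoid setoid

    padded : Word F s i → Fin (i ℕ.* (r ℕ.+ s)) → Carrier
    padded z = flatten F (λ b → pad F r s (z b))

    encode : Word F s i → Word F (r ℕ.+ s) i
    encode z = unflatten F (mulV F M (padded z))

    agree : Fin i → Bool
    agree b = does (symEq? F (encode x b) (encode y b))

    S₀ : Phase
    S₀ = skipFirst (toℕ L)

    phase : Fin i → Phase
    phase = phaseAt S₀ agree

    R C : Subset (i ℕ.* (r ℕ.+ s))
    R = rowSet S₀ agree
    C = columnSet S₀ agree

    phase-L : phase L ≡ matching 0
    phase-L = trans (phaseAt-skipFirst (toℕ L) agree L ℕ.≤-refl) (cong skipFirst (ℕ.n∸n≡0 (toℕ L)))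

    unlessFinished : Phase → Carrier → Carrier
    unlessFinished finished _ = 0#
    unlessFinished _ v = v

    block : Fin (i ℕ.* (r ℕ.+ s)) → Fin i
    block k = proj₁ (remQuot (r ℕ.+ s) k)

    u : Fin (i ℕ.* (r ℕ.+ s)) → Carrier
    u k = unlessFinished (phase (block k)) (padded x k - padded y k)

    u-combine : ∀ b p → u (combine b p) ≡ unlessFinished (phase b) (pad F r s (x b) p - pad F r s (y b) p)
    u-combine b p = cong₂ (λ b′ v → unlessFinished (phase b′) v) (cong proj₁ (Fin.remQuot-combine b p))
      (cong₂ _-_ (flatten-combine (λ b → pad F r s (x b)) b p) (flatten-combine (λ b → pad F r s (y b)) b p))

    u-vanishes-off-C : ∀ k → k ∉ C → u k ≈ 0#
    u-vanishes-off-C k k∉C with b , p , refl ← Fin.combine-surjective {i} {r ℕ.+ s} k =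
      ≈-trans (reflexive (u-combine b p))
              (vanishes b p (k∉C ∘ ∈-concat⁺ (λ b → initial (r ℕ.+ s) (columns (phase b)))))
      where
      vanishes : ∀ b p → p ∉ initial (r ℕ.+ s) (columns (phase b)) →
                 unlessFinished (phase b) (pad F r s (x b) p - pad F r s (y b) p) ≈ 0#
      vanishes b p p∉ with phase b in eq
      ... | skipping _ = x≈y⇒x∙y⁻¹≈ε (pad-cong r s (x≈y-before-L b (phaseAt-skipping (toℕ L) agree b eq)) p)
      ... | matching _ = x≈y⇒x∙y⁻¹≈ε (≈-trans (pad-padding r s (x b) p p≮s) (≈-sym (pad-padding r s (y b) p p≮s)))
        where
        p≮s : ¬ toℕ p ℕ.< s
        p≮s p<s = p∉ (initial-∈⁺ s p p<s)
      ... | finished = ≈-refl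

    Mu-vanishes-on-R : ∀ k → k ∈ R → mulV F M u k ≈ 0#
    Mu-vanishes-on-R k k∈R with b , p , refl ← Fin.combine-surjective {i} {r ℕ.+ s} k
      with agrees , unfinished ← rows-positive (phase b) (agree b)
             (ℕ.≤-<-trans z≤n (initial-∈⁻ _ (∈-concat⁻ (λ b → initial (r ℕ.+ s) (rows (phase b) (agree b))) k∈R)))
      = begin
      mulV F M u (combine b p)
        ≈⟨ ∑-cong masked ⟩
      mulV F M (λ j → padded x j - padded y j) (combine b p)
        ≈⟨ mulV-− M (padded x) (padded y) (combine b p) ⟩
      encode x b p - encode y b p
        ≈⟨ x≈y⇒x∙y⁻¹≈ε (does-sound (symEq? F (encode x b) (encode y b)) agrees p) ⟩
      0# ∎
      where
      masked : ∀ j → M (combine b p) j * u j ≈ M (combine b p) j * (padded x j - padded y j)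
      masked j with phase (block j) in eq
      ... | skipping _ = ≈-refl
      ... | matching _ = ≈-refl
      ... | finished = ≈-trans (vanish _) (≈-sym (vanish _))
        where
        b<block : b Fin.< block j
        b<block = ℕ.≰⇒> (unfinished ∘ phaseAt-finished-mono S₀ agree eq)
        above-diagonal : M (combine b p) j ≈ 0#
        above-diagonal = proj₁ tns (combine b p) j (subst (combine b p Fin.<_) (Fin.combine-remQuot {i} (r ℕ.+ s) j)
                                                      (Fin.combine-monoˡ-< p _ b<block))
        vanish : ∀ v → M (combine b p) j * v ≈ 0#
        vanish v = ≈-trans (*-congʳ above-diagonal) (zeroˡ v)

    not-finished : finalPhase S₀ agree ≢ finished
    not-finished final≡finished = xL≉yL xL≈yL
      where
      ballot : Ballot 0 0 (R) (C)
      ballot = subst₂ (λ e₁ e₂ → Ballot e₁ e₂ (R) (C))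
                      (pending-skipFirst (toℕ L)) (cong pending final≡finished)
                      (run-ballot S₀ agree)
      xL≈yL : SymEq F (x L) (y L)
      xL≈yL p = begin
        x L p              ≈⟨ pad-symbol r s (x L) p ⟨
        pad F r s (x L) q  ≈⟨ x∙y⁻¹≈ε⇒x≈y _ _ difference≈0 ⟩
        pad F r s (y L) q  ≈⟨ pad-symbol r s (y L) p ⟩
        y L p              ∎
        where
        q : Fin (r ℕ.+ s)
        q = inject≤ p (ℕ.m≤n+m s r)
        q∈columns : combine L q ∈ C
        q∈columns = ∈-concat⁺ (λ b → initial (r ℕ.+ s) (columns (phase b)))
          (subst (λ S → q ∈ initial (r ℕ.+ s) (columns S)) (sym phase-L)
            (initial-∈⁺ s q (subst (ℕ._< s) (sym (Fin.toℕ-inject≤ p _)) (Fin.toℕ<n p))))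
        difference≈0 : pad F r s (x L) q - pad F r s (y L) q ≈ 0#
        difference≈0 = subst (λ S → unlessFinished S (pad F r s (x L) q - pad F r s (y L) q) ≈ 0#) phase-L
          (subst (_≈ 0#) (u-combine L q) (ballot-kernel M tns ballot u u-vanishes-off-C Mu-vanishes-on-R _ q∈columns))

    bound : r ℕ.* (i ℕ.∸ toℕ L) ℕ.< (r ℕ.+ s) ℕ.* Δ F (encode x) (encode y)
    bound with finalPhase S₀ agree in eq
    ... | matching _ = subst (λ d → r ℕ.* (i ℕ.∸ toℕ L) ℕ.< (r ℕ.+ s) ℕ.* d)
                             (sym (Δ≡falses (encode x) (encode y)))
                             (skipFirst-run-bound 1≤s (toℕ L) agree (Fin.toℕ<n L) eq)
    ... | skipping _ = contradiction (finalPhase-skipping (toℕ L) agree eq) (ℕ.<⇒≱ (Fin.toℕ<n L))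
    ... | finished = contradiction eq not-finished

open import Data.Nat using (_≤_; _*_; _+_)

theorem2p6 : ∀ {c ℓ} (F : FiniteField c ℓ) (r s n : ℕ) → 1 ≤ r → 1 ≤ s →
    (A : Matrix F (n * (r + s))) → TotallyNonSingular F A →
    IsMDS-TC F n r s A
theorem2p6 F r s n _ 1≤s A tns i i≤n x y x≉y
  with L , split≡L , before-L , xL≉yL ← TreeCode.firstDifference F x y x≉y
  rewrite split≡L =
  TreeCode.Distance.bound F r s 1≤s (topLeft F A i*m≤n*m) (LinearAlgebra.topLeft-totallyNonSingular F A i*m≤n*m tns)
    x y L before-L xL≉yL
  where
  i*m≤n*m : i * (r + s) ≤ n * (r + s)
  i*m≤n*m = ℕ.*-monoˡ-≤ (r + s) i≤n
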